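{- Let $k$ be a positive integer and let $G$ be a graph. Let $X$ be the set of all vertices of $G$ that do not belong to any $k$-subgraph of $G$, and suppose $|X| \geq k$. Then $$ \sum_{v \in X} \deg_G(v) \leq 2(k-1)|X| - \binom{k}{2}. $$
   Context: All graphs are finite, simple and undirected. A $k$-subgraph of $G$ is a subgraph of $G$ with minimum degree at least $k$. -}

module Defs where

open import Data.Nat using (ℕ; _≤_)
open import Data.Bool using (Bool; true; false; if_then_else_)
open import Data.Fin using (Fin)
open import Data.List using (map; allFin)
open import Data.Nat.ListAction using (sum)
open import Data.Product using (Σ; _×_)
open import Relation.Binary.PropositionalEquality using (_≡_)

record Graph (n : ℕ) : Set where
  field
    adj     : Fin n → Fin n → Bool
    adj-sym : ∀ u v → adj u v ≡ adj v u
    adj-irr : ∀ v → adj v v ≡ false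
open Graph public

sumFin : ∀ {n} → (Fin n → ℕ) → ℕ
sumFin {n} f = sum (map f (allFin n))

ind : Bool → ℕ
ind b = if b then 1 else 0

countFin : ∀ {n} → (Fin n → Bool) → ℕ
countFin p = sumFin (λ v → ind (p v))

deg : ∀ {n} → Graph n → Fin n → ℕ
deg G v = countFin (adj G v)

record Subgraph {n : ℕ} (G : Graph n) : Set where
  field
    verts   : Fin n → Bool
    edges   : Fin n → Fin n → Bool
    edges-sym : ∀ u v → edges u v ≡ edges v u
    edges⊆adj : ∀ u v → edges u v ≡ true → adj G u v ≡ true
    edges-ends : ∀ u v → edges u v ≡ true → verts u ≡ true
open Subgraph public

degSub : ∀ {n} {G : Graph n} → Subgraph G → Fin n → ℕ
degSub H v = countFin (edges H v)

IsKSubgraph : ∀ {n} {G : Graph n} → ℕ → Subgraph G → Set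
IsKSubgraph k H = ∀ v → verts H v ≡ true → k ≤ degSub H v

InSomeKSubgraph : ∀ {n} → Graph n → ℕ → Fin n → Set
InSomeKSubgraph G k v = Σ (Subgraph G) (λ H → IsKSubgraph k H × verts H v ≡ true)

{-# OPTIONS --safe #-}
-- If a vertex set A contains every
-- vertex outside X and meets X, some vertex of X ∩ A has fewer than k neighbours in A:
-- otherwise the subgraph induced by A would be a k-subgraph through a vertex of X.
-- Peel such vertices off one at a time, starting from A = V(G). Removing v while m other
-- vertices of X ∩ A remain lowers Σ_{u ∈ X ∩ A} deg_A(u) by deg_A(v) + deg_{X ∩ A - v}(v),
-- which is at most (k-1) + min(k-1, m). Summed over m < |X| these costs total exactly
-- 2(k-1)|X| - C(k,2) as soon as |X| ≥ k.
module Submission where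

open import Defs
open import Data.Bool using (Bool; true; false; if_then_else_; _∧_; not)
open import Data.Bool.Properties
  using (∧-assoc; ∧-identityʳ; ∧-conicalˡ; ∧-conicalʳ; ¬-not) renaming (_≟_ to _≟ᵇ_)
open import Data.Empty using (⊥-elim)
open import Data.Fin using (Fin; zero; suc)
open import Data.Fin.Properties using (_≟_; any?)
open import Data.List using (map; tabulate)
open import Data.Nat using (ℕ; zero; suc; _+_; _*_; _∸_; _⊓_; _≤_; _<_; _>_; s≤s; s≤s⁻¹; z≤n; _≤?_; _<?_)
open import Data.Nat.Combinatorics using (_C_; nC1≡n; nCk+nC[k+1]≡[n+1]C[k+1])
import Data.Nat.ListAction as List
open import Data.Nat.Properties hiding (_≟_)
open import Algebra.Properties.CommutativeMonoid.Sum +-0-commutativeMonoid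
  using (sum; ∑-distrib-+; sum-cong-≗; sum-replicate-zero)
open import Data.Nat.Tactic.RingSolver using (solve-∀)
open import Data.Product using (∃-syntax; _×_; _,_; proj₁; proj₂)
open import Function using (_∘_; id)
open import Function.Bundles using (_⇔_; Equivalence)
open import Relation.Binary.PropositionalEquality
  using (_≡_; refl; sym; trans; cong; cong₂; subst; _≗_; module ≡-Reasoning)
open import Relation.Nullary using (¬_; does; yes; no)
open import Relation.Nullary.Decidable using (_×-dec_)

C2-suc : ∀ n → suc n C 2 ≡ n + n C 2
C2-suc n = trans (sym (nCk+nC[k+1]≡[n+1]C[k+1] n 1)) (cong (_+ n C 2) (nC1≡n n))

[1+n]C2+[1+n]C2≡[1+n]*n : ∀ n → suc n C 2 + suc n C 2 ≡ suc n * n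
[1+n]C2+[1+n]C2≡[1+n]*n zero = refl
[1+n]C2+[1+n]C2≡[1+n]*n (suc n) = begin
  suc (suc n) C 2 + suc (suc n) C 2
    ≡⟨ cong₂ _+_ (C2-suc (suc n)) (C2-suc (suc n)) ⟩
  suc n + suc n C 2 + (suc n + suc n C 2)
    ≡⟨ regroup (suc n) (suc n C 2) ⟩
  suc n + suc n + (suc n C 2 + suc n C 2)
    ≡⟨ cong (suc n + suc n +_) ([1+n]C2+[1+n]C2≡[1+n]*n n) ⟩
  suc n + suc n + suc n * n
    ≡⟨ close n ⟩
  suc (suc n) * suc n ∎
  where
  open ≡-Reasoning
  regroup : ∀ a c → a + c + (a + c) ≡ a + a + (c + c)
  regroup = solve-∀
  close : ∀ m → suc m + suc m + suc m * m ≡ suc (suc m) * suc m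
  close = solve-∀

peelingBound : ℕ → ℕ → ℕ
peelingBound K zero    = 0
peelingBound K (suc m) = K + K ⊓ m + peelingBound K m

peelingBound-≤1+K : ∀ K {m} → m ≤ suc K → peelingBound K m ≡ K * m + m C 2
peelingBound-≤1+K K {zero}  _         = sym (trans (+-identityʳ (K * 0)) (*-zeroʳ K))
peelingBound-≤1+K K {suc m} (s≤s m≤K) = begin
  K + K ⊓ m + peelingBound K m  ≡⟨ cong₂ (λ a b → K + a + b) (m≥n⇒m⊓n≡n m≤K)
                                         (peelingBound-≤1+K K (m≤n⇒m≤1+n m≤K)) ⟩
  K + m + (K * m + m C 2)       ≡⟨ regroup K m (m C 2) ⟩
  K * suc m + (m + m C 2)       ≡⟨ cong (K * suc m +_) (sym (C2-suc m)) ⟩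
  K * suc m + suc m C 2         ∎
  where
  open ≡-Reasoning
  regroup : ∀ K m c → K + m + (K * m + c) ≡ K * suc m + (m + c)
  regroup = solve-∀

peelingBound-closed : ∀ K t → peelingBound K (t + suc K) + suc K C 2 ≡ 2 * K * (t + suc K)
peelingBound-closed K zero = begin
  peelingBound K (suc K) + suc K C 2  ≡⟨ cong (_+ suc K C 2) (peelingBound-≤1+K K ≤-refl) ⟩
  K * suc K + suc K C 2 + suc K C 2   ≡⟨ +-assoc (K * suc K) _ _ ⟩
  K * suc K + (suc K C 2 + suc K C 2) ≡⟨ cong (K * suc K +_) ([1+n]C2+[1+n]C2≡[1+n]*n K) ⟩
  K * suc K + suc K * K               ≡⟨ regroup K ⟩
  2 * K * suc K                       ∎
  where
  open ≡-Reasoning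
  regroup : ∀ K → K * suc K + suc K * K ≡ 2 * K * suc K
  regroup = solve-∀
peelingBound-closed K (suc t) = begin
  K + K ⊓ m + peelingBound K m + suc K C 2  ≡⟨ cong (λ x → K + x + peelingBound K m + _) (m≤n⇒m⊓n≡m K≤m) ⟩
  K + K + peelingBound K m + suc K C 2      ≡⟨ +-assoc (K + K) _ _ ⟩
  K + K + (peelingBound K m + suc K C 2)    ≡⟨ cong (K + K +_) (peelingBound-closed K t) ⟩
  K + K + 2 * K * m                         ≡⟨ regroup K m ⟩
  2 * K * suc m                             ∎
  where
  open ≡-Reasoning
  m = t + suc K
  K≤m : K ≤ m
  K≤m = ≤-trans (n≤1+n K) (m≤n+m (suc K) t)
  regroup : ∀ K m → K + K + 2 * K * m ≡ 2 * K * suc m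
  regroup = solve-∀

peelingBound-≤ : ∀ K {m} → suc K ≤ m → peelingBound K m ≤ 2 * K * m ∸ suc K C 2
peelingBound-≤ K {m} 1+K≤m = m+n≤o⇒m≤o∸n (peelingBound K m) (≤-reflexive closed)
  where
  closed : peelingBound K m + suc K C 2 ≡ 2 * K * m
  closed = subst (λ x → peelingBound K x + suc K C 2 ≡ 2 * K * x)
                 (m∸n+n≡m 1+K≤m) (peelingBound-closed K (m ∸ suc K))

sum-mono-≤ : ∀ {n} {f g : Fin n → ℕ} → (∀ i → f i ≤ g i) → sum f ≤ sum g
sum-mono-≤ {zero}  f≤g = z≤n
sum-mono-≤ {suc n} f≤g = +-mono-≤ (f≤g zero) (sum-mono-≤ (f≤g ∘ suc))

sum-map-tabulate : ∀ {m} n (f : Fin m → ℕ) (g : Fin n → Fin m) →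
                   List.sum (map f (tabulate g)) ≡ sum (f ∘ g)
sum-map-tabulate zero    f g = refl
sum-map-tabulate (suc n) f g = cong (f (g zero) +_) (sum-map-tabulate n f (g ∘ suc))

sumFin≡sum : ∀ {n} (f : Fin n → ℕ) → sumFin f ≡ sum f
sumFin≡sum {n} f = sum-map-tabulate n f id

sum-δ : ∀ {n} (v : Fin n) (f : Fin n → ℕ) → sum (λ u → if does (u ≟ v) then f u else 0) ≡ f v
sum-δ {suc n} zero    f = trans (cong (f zero +_) (sum-replicate-zero n)) (+-identityʳ (f zero))
sum-δ {suc n} (suc v) f = sum-δ v (f ∘ suc)

false≢true : ¬ false ≡ true
false≢true ()

module _ {n : ℕ} where

  _⊆_ : (Fin n → Bool) → (Fin n → Bool) → Set
  Y ⊆ Z = ∀ u → Y u ≡ true → Z u ≡ true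

  _∩_ : (Fin n → Bool) → (Fin n → Bool) → Fin n → Bool
  (Y ∩ Z) u = Y u ∧ Z u

  ∁ : (Fin n → Bool) → Fin n → Bool
  ∁ Y u = not (Y u)

  _─_ : (Fin n → Bool) → Fin n → Fin n → Bool
  (Y ─ v) u = Y u ∧ not (does (u ≟ v))

  ∩-─ : ∀ X A v → X ∩ (A ─ v) ≗ (X ∩ A) ─ v
  ∩-─ X A v u = sym (∧-assoc (X u) (A u) _)

  ─⊆ : ∀ Y v → (Y ─ v) ⊆ Y
  ─⊆ Y v u with Y u
  ... | true = λ _ → refl

  sumOver : (Fin n → Bool) → (Fin n → ℕ) → ℕ
  sumOver Y f = sum (λ u → if Y u then f u else 0)

  count : (Fin n → Bool) → ℕ
  count Y = sumOver Y (λ _ → 1)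

  sumOver-congˡ : ∀ {Y Z} f → Y ≗ Z → sumOver Y f ≡ sumOver Z f
  sumOver-congˡ f Y≗Z = sum-cong-≗ (λ u → cong (λ b → if b then f u else 0) (Y≗Z u))

  sumOver-congʳ : ∀ Y {f g} → f ≗ g → sumOver Y f ≡ sumOver Y g
  sumOver-congʳ Y f≗g = sum-cong-≗ (λ u → cong (λ x → if Y u then x else 0) (f≗g u))

  sumOver-+ : ∀ Y f g → sumOver Y (λ u → f u + g u) ≡ sumOver Y f + sumOver Y g
  sumOver-+ Y f g = trans (sum-cong-≗ split)
                          (∑-distrib-+ (λ u → if Y u then f u else 0) (λ u → if Y u then g u else 0))
    where
    split : ∀ u → (if Y u then f u + g u else 0) ≡ (if Y u then f u else 0) + (if Y u then g u else 0)
    split u with Y u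
    ... | true  = refl
    ... | false = refl

  sumOver-mono : ∀ {Y Z f g} → Y ⊆ Z → (∀ u → Y u ≡ true → f u ≤ g u) → sumOver Y f ≤ sumOver Z g
  sumOver-mono {Y} {Z} {f} {g} Y⊆Z f≤g = sum-mono-≤ pointwise
    where
    pointwise : ∀ u → (if Y u then f u else 0) ≤ (if Z u then g u else 0)
    pointwise u with Y u in Yu
    ... | false = z≤n
    ... | true rewrite Y⊆Z u Yu = f≤g u Yu

  sumOver-─ : ∀ Y {v} f → Y v ≡ true → sumOver Y f ≡ f v + sumOver (Y ─ v) f
  sumOver-─ Y {v} f Yv = begin
    sumOver Y f                       ≡⟨ sum-cong-≗ split ⟩
    sum (λ u → at-v u + off-v u)      ≡⟨ ∑-distrib-+ at-v off-v ⟩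
    sum at-v + sumOver (Y ─ v) f      ≡⟨ cong (_+ sumOver (Y ─ v) f) (sum-δ v f) ⟩
    f v + sumOver (Y ─ v) f           ∎
    where
    open ≡-Reasoning
    at-v off-v : Fin n → ℕ
    at-v  u = if does (u ≟ v) then f u else 0
    off-v u = if (Y ─ v) u then f u else 0
    split : ∀ u → (if Y u then f u else 0) ≡ at-v u + off-v u
    split u with u ≟ v
    ... | yes refl rewrite Yv = sym (+-identityʳ (f u))
    ... | no _     rewrite ∧-identityʳ (Y u) = refl

  sumOver≤count : ∀ Y {f} → (∀ u → f u ≤ 1) → sumOver Y f ≤ count Y
  sumOver≤count Y f≤1 = sumOver-mono (λ _ → id) (λ u _ → f≤1 u)

  count-─ : ∀ Y {v} → Y v ≡ true → count Y ≡ suc (count (Y ─ v))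
  count-─ Y = sumOver-─ Y (λ _ → 1)

  sumOver-empty : ∀ {Y} f → (∀ u → ¬ Y u ≡ true) → sumOver Y f ≡ 0
  sumOver-empty {Y} f empty = trans (sum-cong-≗ vanish) (sum-replicate-zero n)
    where
    vanish : ∀ u → (if Y u then f u else 0) ≡ 0
    vanish u with Y u in Yu
    ... | true  = ⊥-elim (empty u Yu)
    ... | false = refl

  ∁⊆-─ : ∀ {X A v} → ∁ X ⊆ A → X v ≡ true → ∁ X ⊆ (A ─ v)
  ∁⊆-─ {v = v} ∁X⊆A Xv u ∁Xu with u ≟ v
  ... | yes refl rewrite Xv = ⊥-elim (false≢true ∁Xu)
  ... | no _     rewrite ∁X⊆A u ∁Xu = refl

ind≤1 : ∀ b → ind b ≤ 1
ind≤1 true  = ≤-refl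
ind≤1 false = z≤n

module _ {n : ℕ} (G : Graph n) where

  degIn : (Fin n → Bool) → Fin n → ℕ
  degIn A u = sumOver A (λ w → ind (adj G u w))

  degIn≤count : ∀ A u → degIn A u ≤ count A
  degIn≤count A u = sumOver≤count A (λ w → ind≤1 (adj G u w))

  degIn-mono : ∀ {A B} u → A ⊆ B → degIn A u ≤ degIn B u
  degIn-mono u A⊆B = sumOver-mono A⊆B (λ _ _ → ≤-refl)

  degIn≤degIn⊓count : ∀ {Y A} v → Y ⊆ A → degIn Y v ≤ degIn A v ⊓ count Y
  degIn≤degIn⊓count {Y} v Y⊆A = ⊓-glb (degIn-mono v Y⊆A) (degIn≤count Y v)

  degIn-─ : ∀ A {v} u → A v ≡ true → degIn A u ≡ ind (adj G u v) + degIn (A ─ v) u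
  degIn-─ A u = sumOver-─ A (λ w → ind (adj G u w))

  sumOver-adj≡degIn : ∀ Y v → sumOver Y (λ u → ind (adj G u v)) ≡ degIn Y v
  sumOver-adj≡degIn Y v = sumOver-congʳ Y (λ u → cong ind (adj-sym G u v))

  sumOver-degIn-─ : ∀ Y A {v} → Y v ≡ true → A v ≡ true →
    sumOver Y (degIn A) ≡ degIn A v + degIn (Y ─ v) v + sumOver (Y ─ v) (degIn (A ─ v))
  sumOver-degIn-─ Y A {v} Yv Av = begin
    sumOver Y (degIn A)
      ≡⟨ sumOver-─ Y (degIn A) Yv ⟩
    degIn A v + sumOver (Y ─ v) (degIn A)
      ≡⟨ cong (degIn A v +_) (sumOver-congʳ (Y ─ v) (λ u → degIn-─ A u Av)) ⟩
    degIn A v + sumOver (Y ─ v) (λ u → ind (adj G u v) + degIn (A ─ v) u)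
      ≡⟨ cong (degIn A v +_) (sumOver-+ (Y ─ v) _ (degIn (A ─ v))) ⟩
    degIn A v + (sumOver (Y ─ v) (λ u → ind (adj G u v)) + sumOver (Y ─ v) (degIn (A ─ v)))
      ≡⟨ cong (λ e → degIn A v + (e + sumOver (Y ─ v) (degIn (A ─ v)))) (sumOver-adj≡degIn (Y ─ v) v) ⟩
    degIn A v + (degIn (Y ─ v) v + sumOver (Y ─ v) (degIn (A ─ v)))
      ≡⟨ +-assoc (degIn A v) _ _ ⟨
    degIn A v + degIn (Y ─ v) v + sumOver (Y ─ v) (degIn (A ─ v)) ∎
    where open ≡-Reasoning

  induced : (Fin n → Bool) → Subgraph G
  induced A = record
    { verts      = A
    ; edges      = λ u w → A u ∧ A w ∧ adj G u w
    ; edges-sym  = induced-edges-sym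
    ; edges⊆adj  = λ u w e → ∧-conicalʳ (A w) _ (∧-conicalʳ (A u) _ e)
    ; edges-ends = λ u w e → ∧-conicalˡ (A u) _ e
    }
    where
    induced-edges-sym : ∀ u w → A u ∧ A w ∧ adj G u w ≡ A w ∧ A u ∧ adj G w u
    induced-edges-sym u w rewrite adj-sym G u w with A u | A w
    ... | true  | true  = refl
    ... | true  | false = refl
    ... | false | true  = refl
    ... | false | false = refl

  degSub-induced : ∀ A {v} → A v ≡ true → degSub (induced A) v ≡ degIn A v
  degSub-induced A {v} Av = trans (sumFin≡sum (λ w → ind (A v ∧ A w ∧ adj G v w))) (sum-cong-≗ pointwise)
    where
    pointwise : ∀ w → ind (A v ∧ A w ∧ adj G v w) ≡ (if A w then ind (adj G v w) else 0)
    pointwise w rewrite Av with A w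
    ... | true  = refl
    ... | false = refl

  degSub≤degIn : ∀ (H : Subgraph G) {A} → verts H ⊆ A → ∀ v → degSub H v ≤ degIn A v
  degSub≤degIn H {A} H⊆A v = ≤-trans (≤-reflexive (sumFin≡sum (λ w → ind (edges H v w)))) (sum-mono-≤ pointwise)
    where
    pointwise : ∀ w → ind (edges H v w) ≤ (if A w then ind (adj G v w) else 0)
    pointwise w with edges H v w in vw
    ... | false = z≤n
    ... | true rewrite H⊆A w (edges-ends H w v (trans (edges-sym H w v) vw))
                     | edges⊆adj H v w vw = ≤-refl

module _ {n : ℕ} (G : Graph n) (k : ℕ) (X : Fin n → Bool)
         (X⇔noKSubgraph : ∀ v → (X v ≡ true) ⇔ (¬ InSomeKSubgraph G k v)) where

  kSubgraph-avoids : ∀ {H} → IsKSubgraph k H → ∀ u → verts H u ≡ true → X u ≡ false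
  kSubgraph-avoids {H} isK u Hu = ¬-not (λ Xu → Equivalence.to (X⇔noKSubgraph u) Xu (H , isK , Hu))

  -- The hypothesis on X only gives ¬ ¬ InSomeKSubgraph G k w, so the bound is decided.
  ∁⊆⇒degIn≥k : ∀ {A w} → ∁ X ⊆ A → X w ≡ false → k ≤ degIn G A w
  ∁⊆⇒degIn≥k {A} {w} ∁X⊆A Xw with k ≤? degIn G A w
  ... | yes k≤deg = k≤deg
  ... | no  k≰deg = ⊥-elim (false≢true (trans (sym Xw) (Equivalence.from (X⇔noKSubgraph w) noKSubgraph)))
    where
    noKSubgraph : ¬ InSomeKSubgraph G k w
    noKSubgraph (H , isK , Hw) = k≰deg (≤-trans (isK w Hw) (degSub≤degIn G H H⊆A w))
      where
      H⊆A : verts H ⊆ A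
      H⊆A u Hu = ∁X⊆A u (cong not (kSubgraph-avoids {H} isK u Hu))

  ∃-lowDegree : ∀ {A u} → ∁ X ⊆ A → (X ∩ A) u ≡ true → ∃[ v ] ((X ∩ A) v ≡ true × degIn G A v < k)
  ∃-lowDegree {A} {u} ∁X⊆A XAu with any? (λ v → ((X ∩ A) v ≟ᵇ true) ×-dec (degIn G A v <? k))
  ... | yes low = low
  ... | no none = ⊥-elim (Equivalence.to (X⇔noKSubgraph u) (∧-conicalˡ (X u) _ XAu)
                            (induced G A , isK , ∧-conicalʳ (X u) _ XAu))
    where
    degIn≥k : ∀ v → A v ≡ true → k ≤ degIn G A v
    degIn≥k v Av with X v in Xv
    ... | false = ∁⊆⇒degIn≥k ∁X⊆A Xv
    ... | true  = ≮⇒≥ (λ low → none (v , trans (cong (_∧ A v) Xv) Av , low))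
    isK : IsKSubgraph k (induced G A)
    isK v Av = subst (k ≤_) (sym (degSub-induced G A Av)) (degIn≥k v Av)

module _ (K : ℕ) {n : ℕ} (G : Graph n) (X : Fin n → Bool)
         (X⇔noKSubgraph : ∀ v → (X v ≡ true) ⇔ (¬ InSomeKSubgraph G (suc K) v)) where

  sumOver-degIn≤peelingBound : ∀ m A → ∁ X ⊆ A → count (X ∩ A) ≡ m →
                               sumOver (X ∩ A) (degIn G A) ≤ peelingBound K m
  sumOver-degIn≤peelingBound zero A ∁X⊆A |X∩A|≡0 =
    ≤-reflexive (sumOver-empty (degIn G A) (λ u XAu → 1+n≢0 (trans (sym (count-─ (X ∩ A) XAu)) |X∩A|≡0)))
  sumOver-degIn≤peelingBound (suc m) A ∁X⊆A |X∩A|≡1+m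
    with any? (λ u → (X ∩ A) u ≟ᵇ true)
  ... | no empty = ≤-trans (≤-reflexive (sumOver-empty (degIn G A) (λ u XAu → empty (u , XAu)))) z≤n
  ... | yes (u , XAu) = begin
    sumOver Y (degIn G A)
      ≡⟨ sumOver-degIn-─ G Y A Yv Av ⟩
    degIn G A v + degIn G (Y ─ v) v + sumOver (Y ─ v) (degIn G (A ─ v))
      ≡⟨ cong (degIn G A v + degIn G (Y ─ v) v +_) (sumOver-congˡ (degIn G (A ─ v)) (∩-─ X A v)) ⟨
    degIn G A v + degIn G (Y ─ v) v + sumOver (X ∩ (A ─ v)) (degIn G (A ─ v))
      ≤⟨ +-mono-≤ (+-mono-≤ degIn≤K (≤-trans neighbours≤ (⊓-mono-≤ degIn≤K (≤-reflexive |Y─v|≡m))))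
                  (sumOver-degIn≤peelingBound m (A ─ v) ∁X⊆A─v |X∩A─v|≡m) ⟩
    K + K ⊓ m + peelingBound K m ∎
    where
    open ≤-Reasoning
    Y : Fin n → Bool
    Y = X ∩ A
    low : ∃[ v ] (Y v ≡ true × degIn G A v < suc K)
    low = ∃-lowDegree G (suc K) X X⇔noKSubgraph ∁X⊆A XAu
    v : Fin n
    v = proj₁ low
    Yv : Y v ≡ true
    Yv = proj₁ (proj₂ low)
    Av : A v ≡ true
    Av = ∧-conicalʳ (X v) _ Yv
    degIn≤K : degIn G A v ≤ K
    degIn≤K = s≤s⁻¹ (proj₂ (proj₂ low))
    |Y─v|≡m : count (Y ─ v) ≡ m
    |Y─v|≡m = suc-injective (trans (sym (count-─ Y Yv)) |X∩A|≡1+m)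
    |X∩A─v|≡m : count (X ∩ (A ─ v)) ≡ m
    |X∩A─v|≡m = trans (sumOver-congˡ (λ _ → 1) (∩-─ X A v)) |Y─v|≡m
    ∁X⊆A─v : ∁ X ⊆ (A ─ v)
    ∁X⊆A─v = ∁⊆-─ ∁X⊆A (∧-conicalˡ (X v) _ Yv)
    neighbours≤ : degIn G (Y ─ v) v ≤ degIn G A v ⊓ count (Y ─ v)
    neighbours≤ = degIn≤degIn⊓count G v (λ w Yw → ∧-conicalʳ (X w) _ (─⊆ Y v w Yw))

lemma2p2 : (k : ℕ) → k > 0 → (n : ℕ) → (G : Graph n) →
    (X : Fin n → Bool) →
    (∀ v → (X v ≡ true) ⇔ (¬ InSomeKSubgraph G k v)) →
    k ≤ countFin X →
    sumFin (λ v → if X v then deg G v else 0)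
    ≤ 2 * (k ∸ 1) * countFin X ∸ k C 2
lemma2p2 zero    () n G X X⇔noKSubgraph k≤|X|
lemma2p2 (suc K) _ n G X X⇔noKSubgraph k≤|X| = begin
  sumFin (λ v → if X v then deg G v else 0)     ≡⟨ sumFin≡sum (λ v → if X v then deg G v else 0) ⟩
  sumOver X (deg G)                             ≡⟨ sumOver-congʳ X (λ u → sumFin≡sum (λ w → ind (adj G u w))) ⟩
  sumOver X (degIn G full)                      ≡⟨ sumOver-congˡ (degIn G full) X≗X∩full ⟩
  sumOver (X ∩ full) (degIn G full)             ≤⟨ sumOver-degIn≤peelingBound K G X X⇔noKSubgraph
                                                      _ full (λ _ _ → refl) refl ⟩
  peelingBound K (count (X ∩ full))             ≡⟨ cong (peelingBound K) |X|≡|X∩full| ⟨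
  peelingBound K (countFin X)                   ≤⟨ peelingBound-≤ K k≤|X| ⟩
  2 * K * countFin X ∸ suc K C 2                ∎
  where
  open ≤-Reasoning
  full : Fin n → Bool
  full _ = true
  X≗X∩full : X ≗ X ∩ full
  X≗X∩full u = sym (∧-identityʳ (X u))
  |X|≡|X∩full| : countFin X ≡ count (X ∩ full)
  |X|≡|X∩full| = trans (sumFin≡sum (λ u → ind (X u))) (sumOver-congˡ (λ _ → 1) X≗X∩full)
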